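{- For any integer $m\ge 2$ and any prime $p$, we have $g_m(p)=2p$ if and only if $(m,p)\notin\{(2,2),(2,3)\}$.
   Context: $\mathbb{N}=\{0,1,2,\dots\}$. For an integer $m\ge 2$, an $m$-product sequence is a finite sequence of integers $a_1\le a_2\le\dots\le a_t$ such that $\prod_{i=1}^t a_i=R^m$ for some $R\in\mathbb{N}$ and no integer appears more than $m-1$ times in the sequence. For $n\in\mathbb{N}$, $g_m(n)$ is the least integer $s$ such that there exists an $m$-product sequence $a_1\le\dots\le a_t$ with $a_1=n$ and $a_t=s$. -}

module Defs where

open import Data.Nat using (ℕ; _≤_; _<_; _^_; _∸_)
open import Data.Nat.Properties using (_≟_)
open import Data.List using (List; []; _∷_; length; filter; head; last)
open import Data.Nat.ListAction using (product)
open import Data.List.Relation.Unary.Linked using (Linked)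
open import Data.List.Relation.Unary.All using (All)
open import Data.Maybe using (just)
open import Data.Product using (Σ; ∃; _×_)
open import Relation.Binary.PropositionalEquality using (_≡_)

-- a list a₁ ≤ a₂ ≤ … ≤ a_t is an m-product sequence: weakly increasing,
-- product is an m-th power of a natural number, and no value occurs more
-- than m-1 times. (Entries are naturals: the sequences considered start at
-- a₁ = n ∈ ℕ and are non-decreasing, so all entries are ≥ 0.)
IsMProductSeq : ℕ → List ℕ → Set
IsMProductSeq m as =
  Linked _≤_ as
  × (∃ λ (R : ℕ) → product as ≡ R ^ m)
  × All (λ x → length (filter (_≟ x) as) ≤ m ∸ 1) as

Attains : ℕ → ℕ → ℕ → Set
Attains m n s = Σ (List ℕ) λ as →
  IsMProductSeq m as × head as ≡ just n × last as ≡ just s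

-- g_m(n) = s : s is the least integer attained
GEq : ℕ → ℕ → ℕ → Set
GEq m n s = Attains m n s × (∀ s' → Attains m n s' → s ≤ s')

-- If s < 2p, every entry of a sequence from p to s lies in [p, 2p), so p is the only entry
-- divisible by p; it occurs between 1 and m-1 times, so the exponent of p in the product is not
-- a multiple of m. Hence g_m(p) ≥ 2p. For m = 2 the entries are distinct, and a search over the
-- subsets of {2,3,4} and {3,4,5,6} shows that 2p is not attained for p = 2, 3.
-- Conversely, 2^(m-2)·4 and 3²·4·6^(m-2) are m-th powers for m ≥ 3, and for p ≥ 5 pick
-- p < 2^e < 2p. If e ≡ a ≢ 0 (mod m) take p^a, 2^e, (2p)^(m-a). Otherwise write 2^e = 8u and take
-- p^(m-1), 9u, (12u)^(m-2), 2p if p > 6u; else p, (6u)^(m-2), 9u, (2p)^(m-1) if 2p > 9u;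
-- else p^(m-1), 5u, 6u, (15u/2)^(m-1), 2p.

module Submission where

open import Defs
open import Data.Nat using (ℕ; zero; suc; _≟_; _+_; _*_; _^_; _∸_; _≤_; _<_; _≤?_; _<?_; z≤n; s≤s; NonZero; nonTrivial⇒≢1)
open import Data.Nat.Properties
open import Data.Nat.Divisibility using (_∣_; divides; _∣?_; ∣1⇒≡1; ∣-trans; m∣m*n; ∣m⇒∣m*n; *-cancelˡ-∣)
open import Data.Nat.Primality using (Prime; prime; euclidsLemma; prime⇒nonZero; prime⇒irreducible)
open import Data.Nat.DivMod using (_%_; _/_; m%n<n; m≡m%n+[m/n]*n)
open import Data.Nat.ListAction using (product)
open import Data.Nat.ListAction.Properties using (product-++)
open import Data.Nat.Tactic.RingSolver using (solve-∀)
open import Data.List using (List; []; _∷_; _++_; length; filter; head; last; replicate; map)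
open import Data.List.Properties using (filter-++; filter-all; filter-none; filter-accept; filter-reject; length-++; length-replicate)
open import Data.List.Relation.Unary.All as All using (All; []; _∷_)
open import Data.List.Relation.Unary.All.Properties using (++⁺; replicate⁺)
open import Data.List.Relation.Unary.Linked as Linked using (Linked; []; [-]; _∷_)
open import Data.List.Relation.Unary.Linked.Properties using (Linked⇒All; Linked⇒AllPairs)
import Data.List.Relation.Unary.AllPairs as AllPairs
open import Data.List.Relation.Unary.Any as Any using (Any; any?)
open import Data.List.Relation.Binary.Sublist.Propositional using (_⊆_; []; _∷_; _∷ʳ_; minimum)
open import Data.List.Membership.Propositional using (_∈_; lose)
open import Data.List.Membership.Propositional.Properties using (∈-++⁺ˡ; ∈-++⁺ʳ; ∈-map⁺)
open import Data.Maybe using (just)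
open import Data.Maybe.Properties using (≡-dec)
open import Data.Product using (_×_; _,_; proj₁; proj₂; ∃)
open import Data.Sum using (_⊎_; inj₁; inj₂; [_,_])
open import Function using (_∘_; _on_)
open import Function.Bundles using (_⇔_; mk⇔)
open import Relation.Binary using (tri<; tri≈; tri>)
open import Relation.Nullary using (¬_; Dec; yes; no; contradiction)
open import Relation.Nullary.Decidable using (map′; from-no; _×-dec_)
open import Relation.Binary.PropositionalEquality using (_≡_; _≢_; refl; sym; trans; cong; cong₂; subst; module ≡-Reasoning)

^-distrib-* : ∀ a b n → (a * b) ^ n ≡ a ^ n * b ^ n
^-distrib-* a b zero = refl
^-distrib-* a b (suc n) = trans (cong (a * b *_) (^-distrib-* a b n)) (interchange a b (a ^ n) (b ^ n))
  where
  interchange : ∀ a b c d → a * b * (c * d) ≡ a * c * (b * d)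
  interchange = solve-∀

[a*b^k]^n≡a^n*b^[k*n] : ∀ a b k n → (a * b ^ k) ^ n ≡ a ^ n * b ^ (k * n)
[a*b^k]^n≡a^n*b^[k*n] a b k n = trans (^-distrib-* a (b ^ k) n) (cong (a ^ n *_) (^-*-assoc b k n))

n≤n^[1+k] : ∀ n k → n ≤ n ^ suc k
n≤n^[1+k] zero k = z≤n
n≤n^[1+k] n@(suc _) k = m≤m*n n (n ^ k) {{m^n≢0 n k}}

n<2*n : ∀ {n} → 0 < n → n < 2 * n
n<2*n {n} 0<n = subst (n <_) (cong (n +_) (sym (+-identityʳ n))) (m<m+n n 0<n)

power-of-two-between : ∀ k → ∃ λ e → suc k ≤ 2 ^ e × 2 ^ e < 2 * suc k
power-of-two-between zero = 0 , ≤-refl , <ᵇ⇒< 1 2 _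
power-of-two-between (suc k) with power-of-two-between k
... | e , 1+k≤2^e , 2^e<2+2k with 2 + k ≤? 2 ^ e
...   | yes 2+k≤2^e = e , 2+k≤2^e , <-trans 2^e<2+2k (*-monoʳ-< 2 (n<1+n (suc k)))
...   | no 2+k≰2^e = suc e , subst (2 + k ≤_) 2+2k≡2^[1+e] (n<2*n (s≤s z≤n))
                          , subst (_< 2 * (2 + k)) 2+2k≡2^[1+e] (*-monoʳ-< 2 (n<1+n (suc k)))
  where
  2+2k≡2^[1+e] : 2 * suc k ≡ 2 ^ suc e
  2+2k≡2^[1+e] = cong (2 *_) (≤-antisym 1+k≤2^e (≤-pred (≰⇒> 2+k≰2^e)))

count : ℕ → List ℕ → ℕ
count v xs = length (filter (_≟ v) xs)

count-++ : ∀ v xs ys → count v (xs ++ ys) ≡ count v xs + count v ys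
count-++ v xs ys = trans (cong length (filter-++ (_≟ v) xs ys)) (length-++ (filter (_≟ v) xs))

count-here : ∀ v xs → count v (v ∷ xs) ≡ suc (count v xs)
count-here v xs = cong length (filter-accept (_≟ v) refl)

count-there : ∀ v xs {y} → y ≢ v → count v (y ∷ xs) ≡ count v xs
count-there v xs y≢v = cong length (filter-reject (_≟ v) y≢v)

count-replicate : ∀ k v → count v (replicate k v) ≡ k
count-replicate k v = trans (cong length (filter-all (_≟ v) (replicate⁺ k refl))) (length-replicate k)

count-absent : ∀ {v xs} → All (_≢ v) xs → count v xs ≡ 0
count-absent {v} ≢v = cong length (filter-none (_≟ v) ≢v)

count≤count-∷ : ∀ v x xs → count v xs ≤ count v (x ∷ xs)
count≤count-∷ v x xs = subst (count v xs ≤_) (sym (count-++ v (x ∷ []) xs)) (m≤n+m (count v xs) (count v (x ∷ [])))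

-- Sequences given by runs

expand : List (ℕ × ℕ) → List ℕ
expand [] = []
expand ((x , k) ∷ rs) = replicate k x ++ expand rs

runsProduct : List (ℕ × ℕ) → ℕ
runsProduct [] = 1
runsProduct ((x , k) ∷ rs) = x ^ k * runsProduct rs

IncreasingRuns : List (ℕ × ℕ) → Set
IncreasingRuns = Linked (_<_ on proj₁)

All-expand : ∀ {P : ℕ → Set} {rs} → All (P ∘ proj₁) rs → All P (expand rs)
All-expand {rs = []} [] = []
All-expand {rs = (x , k) ∷ rs} (px ∷ ps) = ++⁺ (replicate⁺ k px) (All-expand ps)

first-run-below : ∀ {x k rs} → IncreasingRuns ((x , k) ∷ rs) → All ((x <_) ∘ proj₁) rs
first-run-below l = AllPairs.head (Linked⇒AllPairs <-trans l)

cons-sorted : ∀ {x zs} → All (x ≤_) zs → Linked _≤_ zs → Linked _≤_ (x ∷ zs)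
cons-sorted [] _ = [-]
cons-sorted (x≤z ∷ _) l = x≤z ∷ l

replicate-++-sorted : ∀ k {x ys} → All (x <_) ys → Linked _≤_ ys → Linked _≤_ (replicate k x ++ ys)
replicate-++-sorted zero _ l = l
replicate-++-sorted (suc k) x<ys l =
  cons-sorted (++⁺ (replicate⁺ k ≤-refl) (All.map <⇒≤ x<ys)) (replicate-++-sorted k x<ys l)

expand-sorted : ∀ {rs} → IncreasingRuns rs → Linked _≤_ (expand rs)
expand-sorted {[]} _ = []
expand-sorted {(x , k) ∷ rs} l = replicate-++-sorted k (All-expand (first-run-below l)) (expand-sorted (Linked.tail l))

count-expand : ∀ {rs} → IncreasingRuns rs → All (λ r → count (proj₁ r) (expand rs) ≡ proj₂ r) rs
count-expand {[]} _ = []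
count-expand {(x , k) ∷ rs} l = own ∷ All.zipWith later (first-run-below l , count-expand (Linked.tail l))
  where
  open ≡-Reasoning
  x∉rest : All (_≢ x) (expand rs)
  x∉rest = All.map >⇒≢ (All-expand (first-run-below l))
  own : count x (replicate k x ++ expand rs) ≡ k
  own = begin
    count x (replicate k x ++ expand rs)          ≡⟨ count-++ x (replicate k x) (expand rs) ⟩
    count x (replicate k x) + count x (expand rs) ≡⟨ cong₂ _+_ (count-replicate k x) (count-absent x∉rest) ⟩
    k + 0                                         ≡⟨ +-identityʳ k ⟩
    k                                             ∎
  later : ∀ {r} → x < proj₁ r × count (proj₁ r) (expand rs) ≡ proj₂ r →
          count (proj₁ r) (replicate k x ++ expand rs) ≡ proj₂ r
  later {y , j} (x<y , c≡j) = begin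
    count y (replicate k x ++ expand rs)          ≡⟨ count-++ y (replicate k x) (expand rs) ⟩
    count y (replicate k x) + count y (expand rs) ≡⟨ cong (_+ count y (expand rs)) (count-absent (replicate⁺ k (<⇒≢ x<y))) ⟩
    count y (expand rs)                           ≡⟨ c≡j ⟩
    j                                             ∎

product-replicate : ∀ k x → product (replicate k x) ≡ x ^ k
product-replicate zero x = refl
product-replicate (suc k) x = cong (x *_) (product-replicate k x)

product-expand : ∀ rs → product (expand rs) ≡ runsProduct rs
product-expand [] = refl
product-expand ((x , k) ∷ rs) =
  trans (product-++ (replicate k x) (expand rs)) (cong₂ _*_ (product-replicate k x) (product-expand rs))

last-++ : ∀ xs {ys} {y : ℕ} → last ys ≡ just y → last (xs ++ ys) ≡ just y
last-++ [] e = e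
last-++ (x ∷ []) {[]} ()
last-++ (x ∷ []) {_ ∷ _} e = e
last-++ (x ∷ x′ ∷ xs) e = last-++ (x′ ∷ xs) e

last-expand : ∀ rs x k → last (expand (rs ++ (x , suc k) ∷ [])) ≡ just x
last-expand [] x zero = refl
last-expand [] x (suc k) = last-expand [] x k
last-expand ((y , j) ∷ rs) x k = last-++ (replicate j y) (last-expand rs x k)

runs-attain : ∀ {m x s} rs R → IncreasingRuns rs → All ((_≤ m ∸ 1) ∘ proj₂) rs →
  runsProduct rs ≡ R ^ m → head (expand rs) ≡ just x → last (expand rs) ≡ just s → Attains m x s
runs-attain {m} rs R increasing bounded prod≡ head≡ last≡ =
  expand rs , (expand-sorted increasing , (R , trans (product-expand rs) prod≡) , multiplicities) , head≡ , last≡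
  where
  multiplicities : All (λ y → count y (expand rs) ≤ m ∸ 1) (expand rs)
  multiplicities = All-expand (All.zipWith (λ (c≡k , k≤) → subst (_≤ m ∸ 1) (sym c≡k) k≤) (count-expand increasing , bounded))

prime∤1 : ∀ {p} → Prime p → ¬ p ∣ 1
prime∤1 (prime _) p∣1 = nonTrivial⇒≢1 (∣1⇒≡1 p∣1)

prime∣m^n⇒∣m : ∀ {p m} n → Prime p → p ∣ m ^ n → p ∣ m
prime∣m^n⇒∣m zero pr p∣1 = contradiction p∣1 (prime∤1 pr)
prime∣m^n⇒∣m {m = m} (suc n) pr p∣m*m^n = [ (λ p∣m → p∣m) , prime∣m^n⇒∣m n pr ] (euclidsLemma m (m ^ n) pr p∣m*m^n)

p^k∣p^c*Q⇒k≤c : ∀ {p Q} .{{_ : NonZero p}} → ¬ p ∣ Q → ∀ k c → p ^ k ∣ p ^ c * Q → k ≤ c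
p^k∣p^c*Q⇒k≤c p∤Q zero c _ = z≤n
p^k∣p^c*Q⇒k≤c {p} {Q} p∤Q (suc k) zero p^[1+k]∣Q =
  contradiction (∣-trans (m∣m*n (p ^ k)) (subst (p ^ suc k ∣_) (+-identityʳ Q) p^[1+k]∣Q)) p∤Q
p^k∣p^c*Q⇒k≤c {p} {Q} p∤Q (suc k) (suc c) p^[1+k]∣p^[1+c]*Q =
  s≤s (p^k∣p^c*Q⇒k≤c p∤Q k c (*-cancelˡ-∣ p (subst (p ^ suc k ∣_) (*-assoc p (p ^ c) Q) p^[1+k]∣p^[1+c]*Q)))

-- p divides R, so p^m divides p^c Q.
p^c*Q≡R^m⇒m≤c : ∀ {p Q R} m c → Prime p → ¬ p ∣ Q → 0 < c → p ^ c * Q ≡ R ^ m → m ≤ c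
p^c*Q≡R^m⇒m≤c {p} {Q} {R} m (suc c) pr p∤Q _ e with prime∣m^n⇒∣m m pr (subst (p ∣_) e (∣m⇒∣m*n Q (m∣m*n (p ^ c))))
... | divides d refl = p^k∣p^c*Q⇒k≤c {{prime⇒nonZero pr}} p∤Q m (suc c) (divides (d ^ m) p^m-divides)
  where
  p^m-divides : p ^ suc c * Q ≡ d ^ m * p ^ m
  p^m-divides = trans e (^-distrib-* d p m)

odd-prime : ∀ {p} → Prime p → 2 < p → ¬ 2 ∣ p
odd-prime pr 2<p 2∣p with prime⇒irreducible pr 2∣p
... | inj₁ ()
... | inj₂ 2≡p = <⇒≢ 2<p 2≡p

odd⇒≢2^e : ∀ {p} → 1 < p → ¬ 2 ∣ p → ∀ e → p ≢ 2 ^ e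
odd⇒≢2^e 1<p _ zero refl = <-irrefl refl 1<p
odd⇒≢2^e _ p-odd (suc e) refl = p-odd (divides (2 ^ e) (*-comm 2 (2 ^ e)))

-- The lower bound

p≤y<2p∧p∣y⇒y≡p : ∀ {p y} → p ≤ y → y < 2 * p → p ∣ y → y ≡ p
p≤y<2p∧p∣y⇒y≡p p≤0 _ (divides zero refl) = sym (n≤0⇒n≡0 p≤0)
p≤y<2p∧p∣y⇒y≡p {p} _ _ (divides 1 refl) = +-identityʳ p
p≤y<2p∧p∣y⇒y≡p {p} _ y<2p (divides (suc (suc q)) refl) = contradiction (*-monoˡ-≤ p {2} {2 + q} (s≤s (s≤s z≤n))) (<⇒≱ y<2p)

p≤y<2p⇒y≡p⊎p∤y : ∀ {p y} → p ≤ y → y < 2 * p → y ≡ p ⊎ ¬ p ∣ y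
p≤y<2p⇒y≡p⊎p∤y {p} {y} p≤y y<2p with p ∣? y
... | yes p∣y = inj₁ (p≤y<2p∧p∣y⇒y≡p p≤y y<2p p∣y)
... | no p∤y = inj₂ p∤y

product≡p^count*coprime : ∀ {p} → Prime p → ∀ {ys} → All (λ y → y ≡ p ⊎ ¬ p ∣ y) ys →
  ∃ λ Q → product ys ≡ p ^ count p ys * Q × ¬ p ∣ Q
product≡p^count*coprime pr [] = 1 , refl , prime∤1 pr
product≡p^count*coprime {p} pr {p ∷ ys} (inj₁ refl ∷ rest) with product≡p^count*coprime pr rest
... | Q , e , p∤Q = Q , trans (cong (p *_) e) (trans (sym (*-assoc p _ Q)) (cong (λ c → p ^ c * Q) (sym (count-here p ys)))) , p∤Q
product≡p^count*coprime {p} pr {y ∷ ys} (inj₂ p∤y ∷ rest) with product≡p^count*coprime pr rest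
... | Q , e , p∤Q = y * Q , product≡ , [ p∤y , p∤Q ] ∘ euclidsLemma y Q pr
  where
  open ≡-Reasoning
  y≢p : y ≢ p
  y≢p refl = p∤y (divides 1 (sym (+-identityʳ y)))
  swap : ∀ a b c → a * (b * c) ≡ b * (a * c)
  swap = solve-∀
  product≡ : y * product ys ≡ p ^ count p (y ∷ ys) * (y * Q)
  product≡ = begin
    y * product ys            ≡⟨ cong (y *_) e ⟩
    y * (p ^ count p ys * Q)  ≡⟨ swap y (p ^ count p ys) Q ⟩
    p ^ count p ys * (y * Q)  ≡⟨ cong (λ c → p ^ c * (y * Q)) (sym (count-there p ys y≢p)) ⟩
    p ^ count p (y ∷ ys) * (y * Q) ∎

sorted⇒≤last : ∀ {xs s} → Linked _≤_ xs → last xs ≡ just s → All (_≤ s) xs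
sorted⇒≤last {[]} _ _ = []
sorted⇒≤last {x ∷ []} [-] refl = ≤-refl ∷ []
sorted⇒≤last {x ∷ y ∷ ys} (x≤y ∷ l) e with sorted⇒≤last l e
... | y≤s ∷ ys≤s = ≤-trans x≤y y≤s ∷ y≤s ∷ ys≤s

sorted⇒head≤ : ∀ {x xs} → Linked _≤_ (x ∷ xs) → All (x ≤_) (x ∷ xs)
sorted⇒head≤ = Linked⇒All ≤-trans ≤-refl

0<n≤m∸1⇒n<m : ∀ {n} m → 0 < n → n ≤ m ∸ 1 → n < m
0<n≤m∸1⇒n<m zero 0<n n≤0 = contradiction n≤0 (<⇒≱ 0<n)
0<n≤m∸1⇒n<m (suc m) _ n≤m = s≤s n≤m

-- Below 2p the only multiple of p is p itself, and it occurs between 1 and m-1 times.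
¬attains-below-2p : ∀ {m p s} → Prime p → s < 2 * p → ¬ Attains m p s
¬attains-below-2p {m} {p} {s} pr s<2p (p ∷ xs , (sorted , (R , prod≡) , multiplicities) , refl , last≡)
  with product≡p^count*coprime pr (All.zipWith (λ (p≤y , y≤s) → p≤y<2p⇒y≡p⊎p∤y p≤y (≤-<-trans y≤s s<2p))
                                                (sorted⇒head≤ sorted , sorted⇒≤last sorted last≡))
... | Q , split , p∤Q = <⇒≱ count<m m≤count
  where
  c = count p (p ∷ xs)
  0<c : 0 < c
  0<c = subst (0 <_) (sym (count-here p xs)) (s≤s z≤n)
  m≤count : m ≤ c
  m≤count = p^c*Q≡R^m⇒m≤c m c pr p∤Q 0<c (trans (sym split) prod≡)
  count<m : c < m
  count<m = 0<n≤m∸1⇒n<m m 0<c (All.head multiplicities)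

attains⇒2p≤ : ∀ {m p s} → Prime p → Attains m p s → 2 * p ≤ s
attains⇒2p≤ {m} pr att = ≮⇒≥ λ s<2p → ¬attains-below-2p {m} pr s<2p att

-- The exceptions (m , p) = (2 , 2) and (2 , 3)

count≤1⇒strictly-sorted : ∀ {xs} → Linked _≤_ xs → All (λ y → count y xs ≤ 1) xs → Linked _<_ xs
count≤1⇒strictly-sorted [] _ = []
count≤1⇒strictly-sorted [-] _ = [-]
count≤1⇒strictly-sorted {x ∷ y ∷ ys} (x≤y ∷ l) (cx ∷ cys) =
  ≤∧≢⇒< x≤y x≢y ∷ count≤1⇒strictly-sorted l (All.map (λ {z} → ≤-trans (count≤count-∷ z x (y ∷ ys))) cys)
  where
  x≢y : x ≢ y
  x≢y refl = contradiction (subst (_≤ 1) (trans (count-here x (x ∷ ys)) (cong suc (count-here x ys))) cx) λ { (s≤s ()) }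

interval : ℕ → ℕ → List ℕ
interval a zero = []
interval a (suc k) = a ∷ interval (suc a) k

strictly-sorted⇒⊆interval : ∀ {a} k {xs} → Linked _<_ xs → All (a ≤_) xs → All (_< a + k) xs → xs ⊆ interval a k
strictly-sorted⇒⊆interval k {[]} _ _ _ = minimum _
strictly-sorted⇒⊆interval {a} zero {x ∷ _} _ (a≤x ∷ _) (x<a+0 ∷ _) = contradiction a≤x (<⇒≱ (subst (x <_) (+-identityʳ a) x<a+0))
strictly-sorted⇒⊆interval {a} (suc k) {x ∷ xs} sorted (a≤x ∷ _) x∷xs<a+1+k
  with a ≟ x | All.map (λ {y} → subst (y <_) (+-suc a k)) x∷xs<a+1+k
... | yes refl | _ ∷ xs<1+a+k =
  refl ∷ strictly-sorted⇒⊆interval k (Linked.tail sorted) (AllPairs.head (Linked⇒AllPairs <-trans sorted)) xs<1+a+k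
... | no a≢x | x∷xs<1+a+k =
  a ∷ʳ strictly-sorted⇒⊆interval k sorted (All.map (<-≤-trans (≤∧≢⇒< a≤x a≢x)) (sorted⇒head≤ (Linked.map <⇒≤ sorted))) x∷xs<1+a+k

subsequences : List ℕ → List (List ℕ)
subsequences [] = [] ∷ []
subsequences (x ∷ xs) = map (x ∷_) (subsequences xs) ++ subsequences xs

⊆⇒∈subsequences : ∀ {xs ys} → xs ⊆ ys → xs ∈ subsequences ys
⊆⇒∈subsequences [] = Any.here refl
⊆⇒∈subsequences (y ∷ʳ xs⊆ys) = ∈-++⁺ʳ _ (⊆⇒∈subsequences xs⊆ys)
⊆⇒∈subsequences (refl ∷ xs⊆ys) = ∈-++⁺ˡ (∈-map⁺ (_ ∷_) (⊆⇒∈subsequences xs⊆ys))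

IsPower : ℕ → ℕ → Set
IsPower m n = ∃ λ R → n ≡ R ^ m

isPower? : ∀ k n → Dec (IsPower (suc k) n)
isPower? k n = map′ (λ (R , _ , e) → R , e) (λ (R , e) → R , s≤s (subst (R ≤_) (sym e) (n≤n^[1+k] R k)) , e)
  (anyUpTo? (λ R → n ≟ R ^ suc k) (suc n))

SquareFromTo : ℕ → ℕ → List ℕ → Set
SquareFromTo n s xs = head xs ≡ just n × last xs ≡ just s × IsPower 2 (product xs)

squareFromTo? : ∀ n s xs → Dec (SquareFromTo n s xs)
squareFromTo? n s xs = ≡-dec _≟_ (head xs) (just n) ×-dec ≡-dec _≟_ (last xs) (just s) ×-dec isPower? 1 (product xs)

-- For m = 2 no value repeats, so a sequence from n to s is a subsequence of n, n+1, …, s.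
attains₂⇒squareSubsequence : ∀ {n s} → Attains 2 n s → Any (SquareFromTo n s) (subsequences (interval n (suc s ∸ n)))
attains₂⇒squareSubsequence {n} {s} (n ∷ xs , (sorted , square , multiplicities) , refl , last≡) =
  lose (⊆⇒∈subsequences (strictly-sorted⇒⊆interval (suc s ∸ n) strict (sorted⇒head≤ sorted) below)) (refl , last≡ , square)
  where
  strict = count≤1⇒strictly-sorted sorted multiplicities
  ≤s = sorted⇒≤last sorted last≡
  below : All (_< n + (suc s ∸ n)) (n ∷ xs)
  below = All.map (λ {y} y≤s → subst (y <_) (sym (m+[n∸m]≡n (≤-trans (All.head ≤s) (n≤1+n s)))) (s≤s y≤s)) ≤s

¬attains-2-2-4 : ¬ Attains 2 2 4
¬attains-2-2-4 = from-no (any? (squareFromTo? 2 4) (subsequences (interval 2 3))) ∘ attains₂⇒squareSubsequence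

¬attains-2-3-6 : ¬ Attains 2 3 6
¬attains-2-3-6 = from-no (any? (squareFromTo? 3 6) (subsequences (interval 3 4))) ∘ attains₂⇒squareSubsequence

-- Constructions ending at 2p

attains-2-4 : ∀ n → Attains (3 + n) 2 4
attains-2-4 n = runs-attain ((2 , suc n) ∷ (4 , 1) ∷ []) 2 (<ᵇ⇒< 2 4 _ ∷ [-]) (n≤1+n (suc n) ∷ s≤s z≤n ∷ [])
  (lemma (2 ^ n)) refl (last-expand ((2 , suc n) ∷ []) 4 0)
  where
  lemma : ∀ x → 2 * x * (4 * 1 * 1) ≡ 2 * (2 * (2 * x))
  lemma = solve-∀

attains-3-6 : ∀ n → Attains (3 + n) 3 6
attains-3-6 n = runs-attain ((3 , 2) ∷ (4 , 1) ∷ (6 , suc n) ∷ []) 6 (<ᵇ⇒< 3 4 _ ∷ <ᵇ⇒< 4 6 _ ∷ [-])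
  (s≤s (s≤s z≤n) ∷ s≤s z≤n ∷ n≤1+n (suc n) ∷ []) (lemma (6 ^ n)) refl (last-expand ((3 , 2) ∷ (4 , 1) ∷ []) 6 n)
  where
  lemma : ∀ x → 3 * (3 * 1) * (4 * 1 * (6 * x * 1)) ≡ 6 * (6 * (6 * x))
  lemma = solve-∀

attains-2p-unaligned : ∀ a b t {p e} → e ≡ suc a + t * (suc a + suc b) → p < 2 ^ e → 2 ^ e < 2 * p →
  Attains (suc a + suc b) p (2 * p)
attains-2p-unaligned a b t {p} {e} e≡ p<2^e 2^e<2p =
  runs-attain ((p , A) ∷ (2 ^ e , 1) ∷ (2 * p , B) ∷ []) (p * 2 ^ suc t) (p<2^e ∷ 2^e<2p ∷ [-])
    (subst (A ≤_) (sym (+-suc a b)) (s≤s (m≤m+n a b)) ∷ ≤-trans (s≤s z≤n) (m≤n+m B a) ∷ m≤n+m B a ∷ [])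
    product≡ refl (last-expand ((p , A) ∷ (2 ^ e , 1) ∷ []) (2 * p) b)
  where
  open ≡-Reasoning
  A = suc a
  B = suc b
  m = A + B
  rearrange : ∀ x y z w → x * (y * 1 * (z * w * 1)) ≡ x * w * (y * z)
  rearrange = solve-∀
  exponent : ∀ A B t → A + t * (A + B) + B ≡ (1 + t) * (A + B)
  exponent = solve-∀
  product≡ : p ^ A * (2 ^ e * 1 * ((2 * p) ^ B * 1)) ≡ (p * 2 ^ suc t) ^ m
  product≡ = begin
    p ^ A * (2 ^ e * 1 * ((2 * p) ^ B * 1))   ≡⟨ cong (λ x → p ^ A * (2 ^ e * 1 * (x * 1))) (^-distrib-* 2 p B) ⟩
    p ^ A * (2 ^ e * 1 * (2 ^ B * p ^ B * 1)) ≡⟨ rearrange (p ^ A) (2 ^ e) (2 ^ B) (p ^ B) ⟩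
    p ^ A * p ^ B * (2 ^ e * 2 ^ B)           ≡⟨ sym (cong₂ _*_ (^-distribˡ-+-* p A B) (^-distribˡ-+-* 2 e B)) ⟩
    p ^ m * 2 ^ (e + B)                       ≡⟨ cong (λ k → p ^ m * 2 ^ (k + B)) e≡ ⟩
    p ^ m * 2 ^ (A + t * m + B)               ≡⟨ cong (λ k → p ^ m * 2 ^ k) (exponent A B t) ⟩
    p ^ m * 2 ^ (suc t * m)                   ≡⟨ sym ([a*b^k]^n≡a^n*b^[k*n] p 2 (suc t) m) ⟩
    (p * 2 ^ suc t) ^ m                       ∎

aligned-exponent : ∀ n f t → 3 + f ≡ suc t * (2 + n) → 1 + (f + (2 + f) * n) ≡ (t * suc n + n) * (2 + n)
aligned-exponent n f t e≡ = +-cancelʳ-≡ (3 * suc n) _ _ (begin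
  1 + (f + (2 + f) * n) + 3 * suc n    ≡⟨ lhs f n ⟩
  (3 + f) * suc n + (2 * n + 1)        ≡⟨ cong (λ k → k * suc n + (2 * n + 1)) e≡ ⟩
  suc t * (2 + n) * suc n + (2 * n + 1) ≡⟨ rhs t n ⟩
  (t * suc n + n) * (2 + n) + 3 * suc n ∎)
  where
  open ≡-Reasoning
  lhs : ∀ f n → 1 + (f + (2 + f) * n) + 3 * (1 + n) ≡ (3 + f) * (1 + n) + (2 * n + 1)
  lhs = solve-∀
  rhs : ∀ t n → (1 + t) * (2 + n) * (1 + n) + (2 * n + 1) ≡ (t * (1 + n) + n) * (2 + n) + 3 * (1 + n)
  rhs = solve-∀

attains-2p-via-9u-12u : ∀ n f t p → 3 + f ≡ suc t * (2 + n) → 6 * 2 ^ f < p → p < 9 * 2 ^ f →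
  Attains (2 + n) p (2 * p)
attains-2p-via-9u-12u n f t p e≡ 6u<p p<9u =
  runs-attain ((p , suc n) ∷ (9 * u , 1) ∷ (12 * u , n) ∷ (2 * p , 1) ∷ []) (3 * p * 2 ^ T)
    (p<9u ∷ *-monoˡ-< u (<ᵇ⇒< 9 12 _) ∷ subst (_< 2 * p) (sym (*-assoc 2 6 u)) (*-monoʳ-< 2 6u<p) ∷ [-])
    (≤-refl ∷ s≤s z≤n ∷ n≤1+n n ∷ s≤s z≤n ∷ [])
    product≡ refl (last-expand ((p , suc n) ∷ (9 * u , 1) ∷ (12 * u , n) ∷ []) (2 * p) 0)
  where
  open ≡-Reasoning
  u = 2 ^ f
  instance _ = m^n≢0 2 f
  T = t * suc n + n
  m = 2 + n
  V = 2 ^ ((2 + f) * n)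
  twelve : ∀ x → 12 * x ≡ 3 * (2 * (2 * x))
  twelve = solve-∀
  rearrange : ∀ p P u W V → p * P * (9 * u * 1 * (W * V * (2 * p * 1 * 1)))
                           ≡ 3 * (3 * W) * (p * (p * P)) * (2 * (u * V))
  rearrange = solve-∀
  [12u]^n : (12 * u) ^ n ≡ 3 ^ n * V
  [12u]^n = trans (cong (_^ n) (twelve u)) ([a*b^k]^n≡a^n*b^[k*n] 3 2 (2 + f) n)
  two-power : 2 ^ (T * m) ≡ 2 * (u * V)
  two-power = trans (cong (2 ^_) (sym (aligned-exponent n f t e≡))) (cong (2 *_) (^-distribˡ-+-* 2 f ((2 + f) * n)))
  product≡ : p * p ^ n * (9 * u * 1 * ((12 * u) ^ n * (2 * p * 1 * 1))) ≡ (3 * p * 2 ^ T) ^ m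
  product≡ = begin
    p * p ^ n * (9 * u * 1 * ((12 * u) ^ n * (2 * p * 1 * 1)))
      ≡⟨ cong (λ x → p * p ^ n * (9 * u * 1 * (x * (2 * p * 1 * 1)))) [12u]^n ⟩
    p * p ^ n * (9 * u * 1 * (3 ^ n * V * (2 * p * 1 * 1)))
      ≡⟨ rearrange p (p ^ n) u (3 ^ n) V ⟩
    3 * (3 * 3 ^ n) * (p * (p * p ^ n)) * (2 * (u * V))
      ≡⟨ sym (cong₂ _*_ (^-distrib-* 3 p m) two-power) ⟩
    (3 * p) ^ m * 2 ^ (T * m)
      ≡⟨ sym ([a*b^k]^n≡a^n*b^[k*n] (3 * p) 2 T m) ⟩
    (3 * p * 2 ^ T) ^ m ∎

attains-2p-via-6u-9u : ∀ n f t p → 3 + f ≡ suc t * (2 + n) → p < 6 * 2 ^ f → 9 * 2 ^ f < 2 * p →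
  Attains (2 + n) p (2 * p)
attains-2p-via-6u-9u n f t p e≡ p<6u 9u<2p =
  runs-attain ((p , 1) ∷ (6 * u , n) ∷ (9 * u , 1) ∷ (2 * p , suc n) ∷ []) (3 * p * 2 ^ T)
    (p<6u ∷ *-monoˡ-< u (<ᵇ⇒< 6 9 _) ∷ 9u<2p ∷ [-])
    (s≤s z≤n ∷ n≤1+n n ∷ s≤s z≤n ∷ ≤-refl ∷ [])
    product≡ refl (last-expand ((p , 1) ∷ (6 * u , n) ∷ (9 * u , 1) ∷ []) (2 * p) n)
  where
  open ≡-Reasoning
  u = 2 ^ f
  instance _ = m^n≢0 2 f
  T = t * suc n + n
  m = 2 + n
  V = 2 ^ ((1 + f) * n)
  six : ∀ x → 6 * x ≡ 3 * (2 * x)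
  six = solve-∀
  exponent : ∀ f n → 1 + (f + (2 + f) * n) ≡ 1 + ((1 + f) * n + (f + n))
  exponent = solve-∀
  rearrange : ∀ p P u W V N → p * 1 * (W * V * (9 * u * 1 * (2 * p * (N * P) * 1)))
                             ≡ 3 * (3 * W) * (p * (p * P)) * (2 * (V * (u * N)))
  rearrange = solve-∀
  [6u]^n : (6 * u) ^ n ≡ 3 ^ n * V
  [6u]^n = trans (cong (_^ n) (six u)) ([a*b^k]^n≡a^n*b^[k*n] 3 2 (1 + f) n)
  two-power : 2 ^ (T * m) ≡ 2 * (V * (u * 2 ^ n))
  two-power = begin
    2 ^ (T * m)                           ≡⟨ cong (2 ^_) (sym (aligned-exponent n f t e≡)) ⟩
    2 ^ (1 + (f + (2 + f) * n))           ≡⟨ cong (2 ^_) (exponent f n) ⟩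
    2 * 2 ^ ((1 + f) * n + (f + n))       ≡⟨ cong (2 *_) (^-distribˡ-+-* 2 ((1 + f) * n) (f + n)) ⟩
    2 * (V * 2 ^ (f + n))                 ≡⟨ cong (λ x → 2 * (V * x)) (^-distribˡ-+-* 2 f n) ⟩
    2 * (V * (u * 2 ^ n))                 ∎
  product≡ : p * 1 * ((6 * u) ^ n * (9 * u * 1 * (2 * p * (2 * p) ^ n * 1))) ≡ (3 * p * 2 ^ T) ^ m
  product≡ = begin
    p * 1 * ((6 * u) ^ n * (9 * u * 1 * (2 * p * (2 * p) ^ n * 1)))
      ≡⟨ cong₂ (λ x y → p * 1 * (x * (9 * u * 1 * (2 * p * y * 1)))) [6u]^n (^-distrib-* 2 p n) ⟩
    p * 1 * (3 ^ n * V * (9 * u * 1 * (2 * p * (2 ^ n * p ^ n) * 1)))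
      ≡⟨ rearrange p (p ^ n) u (3 ^ n) V (2 ^ n) ⟩
    3 * (3 * 3 ^ n) * (p * (p * p ^ n)) * (2 * (V * (u * 2 ^ n)))
      ≡⟨ sym (cong₂ _*_ (^-distrib-* 3 p m) two-power) ⟩
    (3 * p) ^ m * 2 ^ (T * m)
      ≡⟨ sym ([a*b^k]^n≡a^n*b^[k*n] (3 * p) 2 T m) ⟩
    (3 * p * 2 ^ T) ^ m ∎

attains-2p-via-10v-12v-15v : ∀ n f t p → 4 + f ≡ t * (2 + n) → p < 10 * 2 ^ f → 15 * 2 ^ f < 2 * p →
  Attains (2 + n) p (2 * p)
attains-2p-via-10v-12v-15v n f t p e≡ p<10v 15v<2p =
  runs-attain ((p , suc n) ∷ (10 * v , 1) ∷ (12 * v , 1) ∷ (15 * v , suc n) ∷ (2 * p , 1) ∷ []) (15 * p * 2 ^ T)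
    (p<10v ∷ *-monoˡ-< v (<ᵇ⇒< 10 12 _) ∷ *-monoˡ-< v (<ᵇ⇒< 12 15 _) ∷ 15v<2p ∷ [-])
    (≤-refl ∷ s≤s z≤n ∷ s≤s z≤n ∷ ≤-refl ∷ s≤s z≤n ∷ [])
    product≡ refl (last-expand ((p , suc n) ∷ (10 * v , 1) ∷ (12 * v , 1) ∷ (15 * v , suc n) ∷ []) (2 * p) 0)
  where
  open ≡-Reasoning
  v = 2 ^ f
  instance _ = m^n≢0 2 f
  T = f + t
  m = 2 + n
  X = 2 ^ (f * n)
  exponent : T * m ≡ 4 + (f + (f + (f + f * n)))
  exponent = begin
    (f + t) * (2 + n)              ≡⟨ *-distribʳ-+ (2 + n) f t ⟩
    f * (2 + n) + t * (2 + n)      ≡⟨ cong (f * (2 + n) +_) (sym e≡) ⟩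
    f * (2 + n) + (4 + f)          ≡⟨ regroup f n ⟩
    4 + (f + (f + (f + f * n)))    ∎
    where
    regroup : ∀ f n → f * (2 + n) + (4 + f) ≡ 4 + (f + (f + (f + f * n)))
    regroup = solve-∀
  two-power : 2 ^ (T * m) ≡ 16 * (v * (v * (v * X)))
  two-power = begin
    2 ^ (T * m)                                 ≡⟨ cong (2 ^_) exponent ⟩
    2 ^ (4 + (f + (f + (f + f * n))))           ≡⟨ ^-distribˡ-+-* 2 4 (f + (f + (f + f * n))) ⟩
    16 * 2 ^ (f + (f + (f + f * n)))            ≡⟨ cong (16 *_) (^-distribˡ-+-* 2 f (f + (f + f * n))) ⟩
    16 * (v * 2 ^ (f + (f + f * n)))            ≡⟨ cong (λ x → 16 * (v * x)) (^-distribˡ-+-* 2 f (f + f * n)) ⟩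
    16 * (v * (v * 2 ^ (f + f * n)))            ≡⟨ cong (λ x → 16 * (v * (v * x))) (^-distribˡ-+-* 2 f (f * n)) ⟩
    16 * (v * (v * (v * X)))                    ∎
  rearrange : ∀ p P v F X → p * P * (10 * v * 1 * (12 * v * 1 * (15 * v * (F * X) * (2 * p * 1 * 1))))
                           ≡ 15 * (15 * F) * (p * (p * P)) * (16 * (v * (v * (v * X))))
  rearrange = solve-∀
  product≡ : p * p ^ n * (10 * v * 1 * (12 * v * 1 * (15 * v * (15 * v) ^ n * (2 * p * 1 * 1)))) ≡ (15 * p * 2 ^ T) ^ m
  product≡ = begin
    p * p ^ n * (10 * v * 1 * (12 * v * 1 * (15 * v * (15 * v) ^ n * (2 * p * 1 * 1))))
      ≡⟨ cong (λ x → p * p ^ n * (10 * v * 1 * (12 * v * 1 * (15 * v * x * (2 * p * 1 * 1))))) ([a*b^k]^n≡a^n*b^[k*n] 15 2 f n) ⟩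
    p * p ^ n * (10 * v * 1 * (12 * v * 1 * (15 * v * (15 ^ n * X) * (2 * p * 1 * 1))))
      ≡⟨ rearrange p (p ^ n) v (15 ^ n) X ⟩
    15 * (15 * 15 ^ n) * (p * (p * p ^ n)) * (16 * (v * (v * (v * X))))
      ≡⟨ sym (cong₂ _*_ (^-distrib-* 15 p m) two-power) ⟩
    (15 * p) ^ m * 2 ^ (T * m)
      ≡⟨ sym ([a*b^k]^n≡a^n*b^[k*n] (15 * p) 2 T m) ⟩
    (15 * p * 2 ^ T) ^ m ∎

attains-2p-below-9u : ∀ n f t p → 3 + f ≡ suc t * (2 + n) → 5 ≤ p → 2 * p ≤ 9 * 2 ^ f → 8 * 2 ^ f < 2 * p →
  Attains (2 + n) p (2 * p)
attains-2p-below-9u n zero t p _ 5≤p 2p≤9 _ = contradiction (≤-trans (*-monoʳ-≤ 2 5≤p) 2p≤9) (<⇒≱ (<ᵇ⇒< 9 10 _))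
attains-2p-below-9u n (suc f) t p e≡ _ 2p≤18v 16v<2p = attains-2p-via-10v-12v-15v n f (suc t) p e≡
  (≤-<-trans (*-cancelˡ-≤ 2 (subst (2 * p ≤_) (regroup 9 v) 2p≤18v)) (*-monoˡ-< v (<ᵇ⇒< 9 10 _)))
  (<-trans (*-monoˡ-< v (<ᵇ⇒< 15 16 _)) (subst (_< 2 * p) (trans (regroup 8 v) (sym (*-assoc 2 8 v))) 16v<2p))
  where
  v = 2 ^ f
  instance _ = m^n≢0 2 f
  regroup : ∀ c x → c * (2 * x) ≡ 2 * (c * x)
  regroup = solve-∀

attains-2p-aligned-8u : ∀ n f t p → 3 + f ≡ suc t * (2 + n) → 5 ≤ p → ¬ 2 ∣ p → p < 8 * 2 ^ f → 8 * 2 ^ f < 2 * p →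
  Attains (2 + n) p (2 * p)
attains-2p-aligned-8u n f t p e≡ 5≤p p-odd p<8u 8u<2p with <-cmp (6 * 2 ^ f) p | 9 * 2 ^ f <? 2 * p
... | tri< 6u<p _ _ | _ = attains-2p-via-9u-12u n f t p e≡ 6u<p (<-trans p<8u (*-monoˡ-< (2 ^ f) {{m^n≢0 2 f}} (<ᵇ⇒< 8 9 _)))
... | tri≈ _ 6u≡p _ | _ = contradiction (divides (3 * 2 ^ f) (trans (sym 6u≡p) (regroup (2 ^ f)))) p-odd
  where
  regroup : ∀ x → 6 * x ≡ 3 * x * 2
  regroup = solve-∀
... | tri> _ _ p<6u | yes 9u<2p = attains-2p-via-6u-9u n f t p e≡ p<6u 9u<2p
... | tri> _ _ _ | no 9u≮2p = attains-2p-below-9u n f t p e≡ 5≤p (≮⇒≥ 9u≮2p) 8u<2p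

attains-2p-aligned : ∀ n t {p} e → e ≡ t * (2 + n) → 5 ≤ p → ¬ 2 ∣ p → p < 2 ^ e → 2 ^ e < 2 * p →
  Attains (2 + n) p (2 * p)
attains-2p-aligned n t 0 _ 5≤p _ p<1 _ = contradiction (≤-trans 5≤p (<⇒≤ p<1)) (<⇒≱ (<ᵇ⇒< 1 5 _))
attains-2p-aligned n t 1 _ 5≤p _ p<2 _ = contradiction (≤-trans 5≤p (<⇒≤ p<2)) (<⇒≱ (<ᵇ⇒< 2 5 _))
attains-2p-aligned n t 2 _ 5≤p _ p<4 _ = contradiction (≤-trans 5≤p (<⇒≤ p<4)) (<⇒≱ (<ᵇ⇒< 4 5 _))
attains-2p-aligned n zero (suc (suc (suc f))) () _ _ _ _
attains-2p-aligned n (suc t) {p} (suc (suc (suc f))) e≡ 5≤p p-odd p<2^e 2^e<2p =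
  attains-2p-aligned-8u n f t p e≡ 5≤p p-odd (subst (p <_) (eight (2 ^ f)) p<2^e) (subst (_< 2 * p) (eight (2 ^ f)) 2^e<2p)
  where
  eight : ∀ x → 2 * (2 * (2 * x)) ≡ 8 * x
  eight = solve-∀

attains-2p : ∀ n p → Prime p → 5 ≤ p → Attains (2 + n) p (2 * p)
attains-2p n p@(suc k) pr 5≤p = by-residue (e % m) (m%n<n e m) (m≡m%n+[m/n]*n e m)
  where
  m = 2 + n
  e = proj₁ (power-of-two-between k)
  p-odd = odd-prime pr (≤-trans (<ᵇ⇒< 2 5 _) 5≤p)
  p<2^e : p < 2 ^ e
  p<2^e = ≤∧≢⇒< (proj₁ (proj₂ (power-of-two-between k))) (odd⇒≢2^e (≤-trans (<ᵇ⇒< 1 5 _) 5≤p) p-odd e)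
  2^e<2p : 2 ^ e < 2 * p
  2^e<2p = proj₂ (proj₂ (power-of-two-between k))
  by-residue : ∀ r → r < m → e ≡ r + e / m * m → Attains m p (2 * p)
  by-residue zero _ e≡ = attains-2p-aligned n (e / m) e e≡ 5≤p p-odd p<2^e 2^e<2p
  by-residue (suc a) a<m e≡ with m≤n⇒∃[o]m+o≡n a<m
  ... | b , 2+a+b≡m = subst (λ m → Attains m p (2 * p)) m≡
        (attains-2p-unaligned a b (e / m) (trans e≡ (cong (λ k → suc a + e / m * k) (sym m≡))) p<2^e 2^e<2p)
    where
    m≡ : suc a + suc b ≡ m
    m≡ = trans (+-suc (suc a) b) 2+a+b≡m

exceptional⇒¬attains : ∀ {m p} → (m ≡ 2 × p ≡ 2) ⊎ (m ≡ 2 × p ≡ 3) → ¬ Attains m p (2 * p)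
exceptional⇒¬attains (inj₁ (refl , refl)) = ¬attains-2-2-4
exceptional⇒¬attains (inj₂ (refl , refl)) = ¬attains-2-3-6

¬exceptional⇒attains : ∀ m p → 2 ≤ m → Prime p → ¬ ((m ≡ 2 × p ≡ 2) ⊎ (m ≡ 2 × p ≡ 3)) → Attains m p (2 * p)
¬exceptional⇒attains 0 _ () _ _
¬exceptional⇒attains 1 _ (s≤s ()) _ _
¬exceptional⇒attains (suc (suc n)) 0 _ (prime {{()}} _) _
¬exceptional⇒attains (suc (suc n)) 1 _ (prime {{()}} _) _
¬exceptional⇒attains 2 2 _ _ ¬exceptional = contradiction (inj₁ (refl , refl)) ¬exceptional
¬exceptional⇒attains (suc (suc (suc n))) 2 _ _ _ = attains-2-4 n
¬exceptional⇒attains 2 3 _ _ ¬exceptional = contradiction (inj₂ (refl , refl)) ¬exceptional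
¬exceptional⇒attains (suc (suc (suc n))) 3 _ _ _ = attains-3-6 n
¬exceptional⇒attains (suc (suc n)) 4 _ pr _ with prime⇒irreducible pr {2} (divides 2 refl)
... | inj₁ ()
... | inj₂ ()
¬exceptional⇒attains (suc (suc n)) p@(suc (suc (suc (suc (suc _))))) _ pr _ = attains-2p n p pr (s≤s (s≤s (s≤s (s≤s (s≤s z≤n)))))

corollary4p11 : (m p : ℕ) → 2 ≤ m → Prime p →
    GEq m p (2 * p) ⇔ (¬ ((m ≡ 2 × p ≡ 2) ⊎ (m ≡ 2 × p ≡ 3)))
corollary4p11 m p 2≤m pr = mk⇔
  (λ (attains , _) exceptional → exceptional⇒¬attains exceptional attains)
  (λ ¬exceptional → ¬exceptional⇒attains m p 2≤m pr ¬exceptional , λ s → attains⇒2p≤ {m} pr)
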